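{- Let $G=(V,E)$ be a simple graph, $C\subseteq V$ such that no vertex of $V\setminus C$ is isolated, and $m$ a positive integer with $m\ge\gamma_{\rm gr}(G;C)$. There is a one-to-one correspondence between dominating legal sequences of $G;C$ and integer solutions of the formulation $F_8$.
   Context: $N\langle v\rangle=N[v]$ (closed neighborhood) if $v\in C$ and $N\langle v\rangle=N(v)$ (open neighborhood) otherwise. A sequence $(v_1,\ldots,v_k)$ of distinct vertices is legal if $N\langle v_i\rangle\setminus\bigcup_{j<i}N\langle v_j\rangle\ne\emptyset$ for $i=2,\ldots,k$, dominating if $\bigcup_jN\langle v_j\rangle=V$; $\gamma_{\rm gr}(G;C)$ is the maximum length of a legal dominating sequence. $F_8$ has binary variables $x_{vi},y_{vi}$ for $v\in V$, $i=1,\ldots,m$, with constants $x_{v0}=1$, and constraints: (a) $\sum_{v\in V}y_{v1}\le1$; (b) $\sum_{i=1}^m y_{vi}\le1$ for $v\in V$; (c) $x_{ui}\le x_{u(i-1)}$ for $u\in V$, $i=2,\ldots,m$; (d) $\sum_{v\in N\langle u\rangle}y_{vi}\ge x_{u(i-1)}-x_{ui}$ for $u\in V$, $i=1,\ldots,m$; (e) $x_{ui}+\sum_{v\in N\langle u\rangle}y_{vi}\le1$ for $u\in V$, $i=1,\ldots,m$; (f) $y_{vi}\le\sum_{u\in N\langle v\rangle}(x_{u(i-1)}-x_{ui})$ for $v\in V$, $i=2,\ldots,m$; (g) $\sum_{v\in V}y_{vi}\le\sum_{v\in V}y_{v(i-1)}$ for $i=2,\ldots,m$; (h) $\sum_{i=1}^m\sum_{v\in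 N\langle u\rangle}y_{vi}\ge1$ for $u\in V$; all variables in $\{0,1\}$. -}

module Defs where

open import Data.Nat as ℕ using (ℕ; zero; suc; _∸_)
open import Data.Integer as ℤ using (ℤ; +_; _-_)
import Data.Integer.Base
open import Data.Bool using (Bool; true; false; _∧_; _∨_; if_then_else_)
open import Data.Fin using (Fin; toℕ; _≟_)
open import Data.List as List using (List; []; _∷_; length; lookup; upTo; allFin)
open import Data.List.Relation.Unary.Any using (Any)
open import Data.List.Relation.Unary.Unique.Propositional using (Unique)
open import Data.Vec as Vec using (Vec)
open import Data.Product using (Σ; ∃; _×_)
open import Data.Sum using (_⊎_)
open import Relation.Binary.PropositionalEquality using (_≡_)
open import Relation.Nullary.Decidable using (⌊_⌋)

SimpleGraph : (n : ℕ) → (Fin n → Fin n → Bool) → Set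
SimpleGraph n adj =
  (∀ u v → adj u v ≡ adj v u) × (∀ v → adj v v ≡ false)

NoIsolatedOutsideC : (n : ℕ) → (Fin n → Fin n → Bool) → (Fin n → Bool) → Set
NoIsolatedOutsideC n adj C = ∀ v → C v ≡ false → ∃ λ u → adj v u ≡ true

module _ {n : ℕ} (adj : Fin n → Fin n → Bool) (C : Fin n → Bool) where

  -- inN v u = true  iff  u ∈ N⟨v⟩
  -- (N⟨v⟩ = N[v] if v ∈ C, N(v) otherwise)
  inN : Fin n → Fin n → Bool
  inN v u = adj v u ∨ (C v ∧ ⌊ u ≟ v ⌋)

  -- for i = 2..k (0-based positions i ≥ 1): N⟨v_i⟩ \ ⋃_{j<i} N⟨v_j⟩ ≠ ∅
  Legal : List (Fin n) → Set
  Legal s = Unique s ×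
    (∀ (i : Fin (length s)) → 1 ℕ.≤ toℕ i →
      ∃ λ w → inN (lookup s i) w ≡ true ×
        (∀ (j : Fin (length s)) → toℕ j ℕ.< toℕ i → inN (lookup s j) w ≡ false))

  Dominating : List (Fin n) → Set
  Dominating s = ∀ w → Any (λ v → inN v w ≡ true) s

  LegalDominating : List (Fin n) → Set
  LegalDominating s = Legal s × Dominating s

  IsGrundyDominationNumber : ℕ → Set
  IsGrundyDominationNumber g =
    (∃ λ s → LegalDominating s × length s ≡ g) ×
    (∀ s → LegalDominating s → length s ℕ.≤ g)

  -- Formulation F8 with parameter m.
  -- Variables: x, y : Vec (Vec ℤ m) n ; entry (v , k) is x_{v,k+1}.

  module F8 (m : ℕ) (x y : Vec (Vec ℤ m) n) where

    nth : List ℤ → ℕ → ℤ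
    nth []       _       = + 0
    nth (a ∷ as) zero    = a
    nth (a ∷ as) (suc k) = nth as k

    -- X u i = x_{ui} for i = 0..m, with the constant x_{u0} = 1
    X : Fin n → ℕ → ℤ
    X u zero    = + 1
    X u (suc k) = nth (Vec.toList (Vec.lookup x u)) k

    Y : Fin n → ℕ → ℤ
    Y v zero    = + 0
    Y v (suc k) = nth (Vec.toList (Vec.lookup y v)) k

    ΣV : (Fin n → ℤ) → ℤ
    ΣV f = List.foldr ℤ._+_ (+ 0) (List.map f (allFin n))

    ΣN : Fin n → (Fin n → ℤ) → ℤ
    ΣN u f = ΣV (λ v → if inN u v then f v else + 0)

    ΣI : (ℕ → ℤ) → ℤ
    ΣI f = List.foldr ℤ._+_ (+ 0) (List.map (λ k → f (suc k)) (upTo m))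

    Binary : ℤ → Set
    Binary z = z ≡ + 0 ⊎ z ≡ + 1

    Solution : Set
    Solution =
      (∀ v (k : Fin m) → Binary (Vec.lookup (Vec.lookup x v) k)) ×
      (∀ v (k : Fin m) → Binary (Vec.lookup (Vec.lookup y v) k)) ×
      (ΣV (λ v → Y v 1) ℤ.≤ + 1) ×
      (∀ v → ΣI (λ i → Y v i) ℤ.≤ + 1) ×
      (∀ u i → 2 ℕ.≤ i → i ℕ.≤ m → X u i ℤ.≤ X u (i ∸ 1)) ×
      (∀ u i → 1 ℕ.≤ i → i ℕ.≤ m → ΣN u (λ v → Y v i) ℤ.≥ X u (i ∸ 1) - X u i) ×
      (∀ u i → 1 ℕ.≤ i → i ℕ.≤ m → X u i ℤ.+ ΣN u (λ v → Y v i) ℤ.≤ + 1) ×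
      (∀ v i → 2 ℕ.≤ i → i ℕ.≤ m → Y v i ℤ.≤ ΣN v (λ u → X u (i ∸ 1) - X u i)) ×
      (∀ i → 2 ℕ.≤ i → i ℕ.≤ m → ΣV (λ v → Y v i) ℤ.≤ ΣV (λ v → Y v (i ∸ 1))) ×
      (∀ u → ΣI (λ i → ΣN u (λ v → Y v i)) ℤ.≥ + 1)

  F8Solution : (m : ℕ) → Vec (Vec ℤ m) n × Vec (Vec ℤ m) n → Set
  F8Solution m (x Data.Product., y) = F8.Solution m x y

  OneToOne : (m : ℕ) → Set
  OneToOne m =
    Σ (List (Fin n) → Vec (Vec ℤ m) n × Vec (Vec ℤ m) n) λ f →
    Σ (Vec (Vec ℤ m) n × Vec (Vec ℤ m) n → List (Fin n)) λ g →
      (∀ s → LegalDominating s → F8Solution m (f s)) ×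
      (∀ z → F8Solution m z → LegalDominating (g z)) ×
      (∀ s → LegalDominating s → g (f s) ≡ s) ×
      (∀ z → F8Solution m z → f (g z) ≡ z)

-- Encode a sequence s by y_{vi} = 1 iff v is the i-th vertex of s, and x_{ui} = 0 iff
-- u ∈ N⟨s₁⟩ ∪ ⋯ ∪ N⟨sᵢ⟩. In a simple graph N⟨·⟩ is symmetric, so the sums over v ∈ N⟨u⟩
-- in (d), (e), (h) count the chosen vertices that dominate u. Constraints (a) and (g) force
-- every column of y to contain at most one 1, and all later columns to vanish once one does,
-- so y encodes exactly one sequence; (c), (d) and (e) then determine x from y column by
-- column, and (b), (f), (h) say precisely that this sequence is repetition-free, legal and
-- dominating. Since γ_gr ≤ m, every legal dominating sequence fits into the m columns, so
-- encoding and decoding are mutually inverse.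
module Submission where

open import Data.Bool using (Bool; true; false; not; _∧_; _∨_; if_then_else_)
open import Data.Bool.Properties using (∨-zeroʳ; ∨-identityʳ; ∧-zeroʳ)
open import Data.Empty using (⊥-elim)
open import Data.Fin as Fin using (Fin; toℕ; _≟_)
open import Data.Fin.Properties using (any?)
open import Data.Integer as ℤ using (ℤ; +_; 0ℤ; 1ℤ; _+_; _-_; +≤+)
import Data.Integer.Properties as ℤ
open import Data.List using (List; []; _∷_; foldr; map; length; lookup; upTo; allFin)
open import Data.List.Membership.Propositional using (_∈_; find; lose)
open import Data.List.Membership.Propositional.Properties using (∈-allFin; ∈-upTo⁺; ∈-upTo⁻)
open import Data.List.Relation.Unary.All as All using (All; []; _∷_)
open import Data.List.Relation.Unary.AllPairs using ([]; _∷_)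
open import Data.List.Relation.Unary.Any using (here; there)
open import Data.List.Relation.Unary.Unique.Propositional using (Unique)
open import Data.List.Relation.Unary.Unique.Propositional.Properties using (allFin⁺; upTo⁺)
open import Data.Nat as ℕ using (ℕ; zero; suc; z≤n; s≤s; _<_; _≤_; _∸_)
import Data.Nat.Properties as ℕ
open import Data.Product using (Σ; ∃; _×_; _,_; proj₁; proj₂)
open import Data.Sum using (_⊎_; inj₁; inj₂)
open import Data.Vec as Vec using (Vec; []; _∷_)
import Data.Vec.Properties as Vec
open import Function using (_∘_; _⇔_; mk⇔; Equivalence)
open import Relation.Binary.Definitions using (DecidableEquality)
open import Relation.Binary.PropositionalEquality
open import Relation.Nullary using (¬_; Dec; yes; no)
open import Relation.Nullary.Decidable using (⌊_⌋; isYes≗does; dec-false)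

open import Defs

IsBit : ℤ → Set
IsBit z = z ≡ 0ℤ ⊎ z ≡ 1ℤ

IsBit⇒0≤ : ∀ {z} → IsBit z → 0ℤ ℤ.≤ z
IsBit⇒0≤ (inj₁ refl) = +≤+ z≤n
IsBit⇒0≤ (inj₂ refl) = +≤+ z≤n

𝟙 : Bool → ℤ
𝟙 b = if b then 1ℤ else 0ℤ

𝟙-isBit : ∀ b → IsBit (𝟙 b)
𝟙-isBit true  = inj₂ refl
𝟙-isBit false = inj₁ refl

𝟙-injective : ∀ a b → 𝟙 a ≡ 𝟙 b → a ≡ b
𝟙-injective true  true  _ = refl
𝟙-injective false false _ = refl

1≤𝟙⇒true : ∀ b → 1ℤ ℤ.≤ 𝟙 b → b ≡ true
1≤𝟙⇒true true _ = refl
1≤𝟙⇒true false (+≤+ ())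

if-isBit : ∀ b {z} → IsBit z → IsBit (if b then z else 0ℤ)
if-isBit true  z-bit = z-bit
if-isBit false _     = inj₁ refl

1≤if⇒ : ∀ b {z} → 1ℤ ℤ.≤ (if b then z else 0ℤ) → b ≡ true × 1ℤ ℤ.≤ z
1≤if⇒ true  1≤z = refl , 1≤z
1≤if⇒ false (+≤+ ())

∑ : {A : Set} → List A → (A → ℤ) → ℤ
∑ xs f = foldr _+_ 0ℤ (map f xs)

module _ {A : Set} where

  ∑-nonneg : ∀ xs (f : A → ℤ) → (∀ a → 0ℤ ℤ.≤ f a) → 0ℤ ℤ.≤ ∑ xs f
  ∑-nonneg []       f f≥0 = ℤ.≤-refl
  ∑-nonneg (a ∷ xs) f f≥0 = ℤ.+-mono-≤ (f≥0 a) (∑-nonneg xs f f≥0)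

  term≤∑ : ∀ xs (f : A → ℤ) → (∀ a → 0ℤ ℤ.≤ f a) → ∀ {a} → a ∈ xs → f a ℤ.≤ ∑ xs f
  term≤∑ (b ∷ xs) f f≥0 (here refl) =
    subst (ℤ._≤ f b + ∑ xs f) (ℤ.+-identityʳ (f b)) (ℤ.+-monoʳ-≤ (f b) (∑-nonneg xs f f≥0))
  term≤∑ (b ∷ xs) f f≥0 {a} (there a∈xs) =
    subst (ℤ._≤ f b + ∑ xs f) (ℤ.+-identityˡ (f a)) (ℤ.+-mono-≤ (f≥0 b) (term≤∑ xs f f≥0 a∈xs))

  ∑-zero : ∀ xs (f : A → ℤ) → (∀ a → f a ≡ 0ℤ) → ∑ xs f ≡ 0ℤ
  ∑-zero []       f f≡0 = refl
  ∑-zero (a ∷ xs) f f≡0 rewrite f≡0 a | ∑-zero xs f f≡0 = refl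

  ∑-cong : ∀ xs (f g : A → ℤ) → (∀ a → a ∈ xs → f a ≡ g a) → ∑ xs f ≡ ∑ xs g
  ∑-cong []       f g f≗g = refl
  ∑-cong (a ∷ xs) f g f≗g =
    cong₂ _+_ (f≗g a (here refl)) (∑-cong xs f g (λ b b∈xs → f≗g b (there b∈xs)))

  1≤∑⇒∃ : ∀ xs (f : A → ℤ) → 1ℤ ℤ.≤ ∑ xs f → ∃ λ a → a ∈ xs × 1ℤ ℤ.≤ f a
  1≤∑⇒∃ []       f (+≤+ ())
  1≤∑⇒∃ (a ∷ xs) f 1≤∑ with 1ℤ ℤ.≤? f a
  ... | yes 1≤fa = a , here refl , 1≤fa
  ... | no  1≰fa =
    let b , b∈xs , 1≤fb = 1≤∑⇒∃ xs f (ℤ.≤-trans 1≤∑ fa+∑≤∑) in b , there b∈xs , 1≤fb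
    where
    fa+∑≤∑ : f a + ∑ xs f ℤ.≤ ∑ xs f
    fa+∑≤∑ = subst (f a + ∑ xs f ℤ.≤_) (ℤ.+-identityˡ (∑ xs f))
               (ℤ.+-monoˡ-≤ (∑ xs f) (ℤ.i<j⇒i≤pred[j] (ℤ.≰⇒> 1≰fa)))

  ∑≤1⇒one-is-unique : ∀ xs (f : A → ℤ) → (∀ a → 0ℤ ℤ.≤ f a) → ∑ xs f ℤ.≤ 1ℤ →
                      ∀ {a b} → a ∈ xs → b ∈ xs → f a ≡ 1ℤ → f b ≡ 1ℤ → a ≡ b
  ∑≤1⇒one-is-unique (c ∷ xs) f f≥0 ∑≤1 (here refl) (here refl) _ _ = refl
  ∑≤1⇒one-is-unique (c ∷ xs) f f≥0 ∑≤1 (here refl) (there b∈xs) fc≡1 fb≡1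
    with ℤ.≤-trans (ℤ.+-monoʳ-≤ (f c) (term≤∑ xs f f≥0 b∈xs)) ∑≤1
  ... | 2≤1 rewrite fc≡1 | fb≡1 with 2≤1
  ... | +≤+ (s≤s ())
  ∑≤1⇒one-is-unique (c ∷ xs) f f≥0 ∑≤1 (there a∈xs) (here refl) fa≡1 fc≡1
    with ℤ.≤-trans (ℤ.+-monoʳ-≤ (f c) (term≤∑ xs f f≥0 a∈xs)) ∑≤1
  ... | 2≤1 rewrite fc≡1 | fa≡1 with 2≤1
  ... | +≤+ (s≤s ())
  ∑≤1⇒one-is-unique (c ∷ xs) f f≥0 ∑≤1 (there a∈xs) (there b∈xs) =
    ∑≤1⇒one-is-unique xs f f≥0 (ℤ.≤-trans ∑xs≤ ∑≤1) a∈xs b∈xs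
    where
    ∑xs≤ : ∑ xs f ℤ.≤ f c + ∑ xs f
    ∑xs≤ = subst (ℤ._≤ f c + ∑ xs f) (ℤ.+-identityˡ (∑ xs f)) (ℤ.+-monoˡ-≤ (∑ xs f) (f≥0 c))

  ∑-bits≡0 : ∀ xs (f : A → ℤ) → (∀ a → IsBit (f a)) → All (λ a → ¬ f a ≡ 1ℤ) xs → ∑ xs f ≡ 0ℤ
  ∑-bits≡0 []       f bit []             = refl
  ∑-bits≡0 (a ∷ xs) f bit (fa≢1 ∷ fxs≢1) with bit a
  ... | inj₁ fa≡0 rewrite fa≡0 = trans (ℤ.+-identityˡ _) (∑-bits≡0 xs f bit fxs≢1)
  ... | inj₂ fa≡1 = ⊥-elim (fa≢1 fa≡1)

  ∑-bits≤1 : ∀ xs (f : A → ℤ) → Unique xs → (∀ a → IsBit (f a)) →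
             (∀ a b → f a ≡ 1ℤ → f b ≡ 1ℤ → a ≡ b) → ∑ xs f ℤ.≤ 1ℤ
  ∑-bits≤1 []       f _            bit one-unique = +≤+ z≤n
  ∑-bits≤1 (a ∷ xs) f (a∉xs ∷ uxs) bit one-unique with bit a
  ... | inj₁ fa≡0 rewrite fa≡0 =
    subst (ℤ._≤ 1ℤ) (sym (ℤ.+-identityˡ _)) (∑-bits≤1 xs f uxs bit one-unique)
  ... | inj₂ fa≡1 rewrite fa≡1
                        | ∑-bits≡0 xs f bit (All.map (λ a≢b fb≡1 → a≢b (one-unique _ _ fa≡1 fb≡1)) a∉xs)
                        = ℤ.≤-refl

module Positions {A : Set} (_≟_ : DecidableEquality A) where

  ⌊≟⌋⇒≡ : ∀ {a b} → ⌊ a ≟ b ⌋ ≡ true → a ≡ b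
  ⌊≟⌋⇒≡ {a} {b} _ with a ≟ b
  ⌊≟⌋⇒≡ _  | yes a≡b = a≡b
  ⌊≟⌋⇒≡ () | no  _

  ⌊≟⌋-refl : ∀ a → ⌊ a ≟ a ⌋ ≡ true
  ⌊≟⌋-refl a with a ≟ a
  ... | yes _  = refl
  ... | no a≢a = ⊥-elim (a≢a refl)

  occursAt : List A → ℕ → A → Bool
  occursAt []       _       _ = false
  occursAt (b ∷ xs) zero    a = ⌊ b ≟ a ⌋
  occursAt (b ∷ xs) (suc k) a = occursAt xs k a

  occursAt-lookup : ∀ xs (i : Fin (length xs)) → occursAt xs (toℕ i) (lookup xs i) ≡ true
  occursAt-lookup (b ∷ xs) Fin.zero    = ⌊≟⌋-refl b
  occursAt-lookup (b ∷ xs) (Fin.suc i) = occursAt-lookup xs i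

  occursAt⇒lookup : ∀ xs k a → occursAt xs k a ≡ true →
                    Σ (Fin (length xs)) λ i → toℕ i ≡ k × lookup xs i ≡ a
  occursAt⇒lookup (b ∷ xs) zero    a occ = Fin.zero , refl , ⌊≟⌋⇒≡ occ
  occursAt⇒lookup (b ∷ xs) (suc k) a occ =
    let i , i≡k , xsᵢ≡a = occursAt⇒lookup xs k a occ in Fin.suc i , cong suc i≡k , xsᵢ≡a

  occursAt-functional : ∀ xs k {a b} → occursAt xs k a ≡ true → occursAt xs k b ≡ true → a ≡ b
  occursAt-functional (c ∷ xs) zero    occ₁ occ₂ = trans (sym (⌊≟⌋⇒≡ occ₁)) (⌊≟⌋⇒≡ occ₂)
  occursAt-functional (c ∷ xs) (suc k) occ₁ occ₂ = occursAt-functional xs k occ₁ occ₂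

  occursAt⇒< : ∀ xs k {a} → occursAt xs k a ≡ true → k < length xs
  occursAt⇒< (b ∷ xs) zero    _   = s≤s z≤n
  occursAt⇒< (b ∷ xs) (suc k) occ = s≤s (occursAt⇒< xs k occ)

  <⇒occursAt : ∀ xs k → k < length xs → ∃ λ a → occursAt xs k a ≡ true
  <⇒occursAt (b ∷ xs) zero    _         = b , ⌊≟⌋-refl b
  <⇒occursAt (b ∷ xs) (suc k) (s≤s k<n) = <⇒occursAt xs k k<n

  occursAt-beyond : ∀ xs k a → length xs ≤ k → occursAt xs k a ≡ false
  occursAt-beyond []       k       a _         = refl
  occursAt-beyond (b ∷ xs) (suc k) a (s≤s len≤k) = occursAt-beyond xs k a len≤k

  occursAt⇒∈ : ∀ xs k {a} → occursAt xs k a ≡ true → a ∈ xs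
  occursAt⇒∈ (b ∷ xs) zero    occ = here (sym (⌊≟⌋⇒≡ occ))
  occursAt⇒∈ (b ∷ xs) (suc k) occ = there (occursAt⇒∈ xs k occ)

  ∈⇒occursAt : ∀ xs {a} → a ∈ xs → ∃ λ k → occursAt xs k a ≡ true
  ∈⇒occursAt (b ∷ xs) (here refl) = zero , ⌊≟⌋-refl b
  ∈⇒occursAt (b ∷ xs) (there a∈xs) = let k , occ = ∈⇒occursAt xs a∈xs in suc k , occ

  OccursOnce : List A → Set
  OccursOnce xs = ∀ j k a → occursAt xs j a ≡ true → occursAt xs k a ≡ true → j ≡ k

  unique⇒occursOnce : ∀ xs → Unique xs → OccursOnce xs
  unique⇒occursOnce (b ∷ xs) _ zero zero a _ _ = refl
  unique⇒occursOnce (b ∷ xs) (b∉xs ∷ _) zero (suc k) a occ₁ occ₂ with ⌊≟⌋⇒≡ occ₁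
  ... | refl = ⊥-elim (All.lookup b∉xs (occursAt⇒∈ xs k occ₂) refl)
  unique⇒occursOnce (b ∷ xs) (b∉xs ∷ _) (suc j) zero a occ₁ occ₂ with ⌊≟⌋⇒≡ occ₂
  ... | refl = ⊥-elim (All.lookup b∉xs (occursAt⇒∈ xs j occ₁) refl)
  unique⇒occursOnce (b ∷ xs) (_ ∷ uxs) (suc j) (suc k) a occ₁ occ₂ =
    cong suc (unique⇒occursOnce xs uxs j k a occ₁ occ₂)

  occursOnce⇒unique : ∀ xs → OccursOnce xs → Unique xs
  occursOnce⇒unique []       _    = []
  occursOnce⇒unique (b ∷ xs) once =
    All.tabulate b∉xs ∷
    occursOnce⇒unique xs (λ j k a occ₁ occ₂ → ℕ.suc-injective (once (suc j) (suc k) a occ₁ occ₂))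
    where
    b∉xs : ∀ {a} → a ∈ xs → ¬ b ≡ a
    b∉xs a∈xs refl with ∈⇒occursAt xs a∈xs
    ... | k , occ with once zero (suc k) b (⌊≟⌋-refl b) occ
    ... | ()

  occursAt-ext : ∀ xs ys → (∀ k a → occursAt xs k a ≡ occursAt ys k a) → xs ≡ ys
  occursAt-ext []       []       _   = refl
  occursAt-ext []       (c ∷ ys) xs≗ys with trans (xs≗ys zero c) (⌊≟⌋-refl c)
  ... | ()
  occursAt-ext (b ∷ xs) []       xs≗ys with trans (sym (xs≗ys zero b)) (⌊≟⌋-refl b)
  ... | ()
  occursAt-ext (b ∷ xs) (c ∷ ys) xs≗ys =
    cong₂ _∷_ (sym (⌊≟⌋⇒≡ (trans (sym (xs≗ys zero b)) (⌊≟⌋-refl b))))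
              (occursAt-ext xs ys (λ k → xs≗ys (suc k)))

  module Covering (N : A → A → Bool) where

    covered : List A → ℕ → A → Bool
    covered []       _       _ = false
    covered (b ∷ xs) zero    _ = false
    covered (b ∷ xs) (suc k) u = N b u ∨ covered xs k u

    covered-zero : ∀ xs u → covered xs 0 u ≡ false
    covered-zero []       u = refl
    covered-zero (b ∷ xs) u = refl

    covered⇒∃ : ∀ xs k u → covered xs k u ≡ true →
                ∃ λ j → j < k × ∃ λ v → occursAt xs j v ≡ true × N v u ≡ true
    covered⇒∃ (b ∷ xs) (suc k) u cov with N b u in Nbu
    ... | true  = zero , s≤s z≤n , b , ⌊≟⌋-refl b , Nbu
    ... | false = let j , j<k , v , occ , Nvu = covered⇒∃ xs k u cov in suc j , s≤s j<k , v , occ , Nvu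

    ∃⇒covered : ∀ xs {j k v u} → j < k → occursAt xs j v ≡ true → N v u ≡ true → covered xs k u ≡ true
    ∃⇒covered (b ∷ xs) {zero}  {suc k} {v} {u} _ occ Nvu rewrite ⌊≟⌋⇒≡ occ | Nvu = refl
    ∃⇒covered (b ∷ xs) {suc j} {suc k} {v} {u} (s≤s j<k) occ Nvu
      rewrite ∃⇒covered xs j<k occ Nvu = ∨-zeroʳ (N b u)

    uncovered⇒¬N : ∀ xs {j k v u} → covered xs k u ≡ false → j < k → occursAt xs j v ≡ true → N v u ≡ false
    uncovered⇒¬N xs {v = v} {u} uncov j<k occ with N v u in Nvu
    ... | false = refl
    ... | true  = trans (sym (∃⇒covered xs j<k occ Nvu)) uncov

    ¬N⇒uncovered : ∀ xs k u → (∀ j v → j < k → occursAt xs j v ≡ true → N v u ≡ false) → covered xs k u ≡ false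
    ¬N⇒uncovered xs k u ¬N with covered xs k u in cov
    ... | false = refl
    ... | true  = let j , j<k , v , occ , Nvu = covered⇒∃ xs k u cov in trans (sym Nvu) (¬N j v j<k occ)

    covered-suc : ∀ xs k u → covered xs k u ≡ true → covered xs (suc k) u ≡ true
    covered-suc xs k u cov =
      let j , j<k , v , occ , Nvu = covered⇒∃ xs k u cov in ∃⇒covered xs (ℕ.m≤n⇒m≤1+n j<k) occ Nvu

    newly-covered : ∀ xs k u → covered xs k u ≡ false → covered xs (suc k) u ≡ true →
                    ∃ λ v → occursAt xs k v ≡ true × N v u ≡ true
    newly-covered xs k u uncov cov with covered⇒∃ xs (suc k) u cov
    ... | j , s≤s j≤k , v , occ , Nvu with ℕ.m≤n⇒m<n∨m≡n j≤k
    ... | inj₂ refl = v , occ , Nvu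
    ... | inj₁ j<k with trans (sym (∃⇒covered xs j<k occ Nvu)) uncov
    ... | ()

⌊⌋-false : ∀ {P : Set} (p? : Dec P) → ¬ P → ⌊ p? ⌋ ≡ false
⌊⌋-false p? ¬p = trans (isYes≗does p?) (dec-false p? ¬p)

inN-sym : ∀ {n} {adj : Fin n → Fin n → Bool} (C : Fin n → Bool) → SimpleGraph n adj →
          ∀ u v → inN adj C u v ≡ inN adj C v u
inN-sym {adj = adj} C (adj-sym , _) u v = by-cases (u ≟ v)
  where
  by-cases : Dec (u ≡ v) → inN adj C u v ≡ inN adj C v u
  by-cases (yes refl) = refl
  by-cases (no u≢v) rewrite ⌊⌋-false (v ≟ u) (u≢v ∘ sym) | ⌊⌋-false (u ≟ v) u≢v
                          | ∧-zeroʳ (C u) | ∧-zeroʳ (C v) | ∨-identityʳ (adj u v) | ∨-identityʳ (adj v u)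
                          = adj-sym u v

module Formulation {n : ℕ} {adj : Fin n → Fin n → Bool} (C : Fin n → Bool) (simple : SimpleGraph n adj) where

  N : Fin n → Fin n → Bool
  N = inN adj C

  N-sym : ∀ u v → N u v ≡ N v u
  N-sym = inN-sym C simple

  open Positions (_≟_ {n})
  open Covering N

  ΣV : (Fin n → ℤ) → ℤ
  ΣV f = ∑ (allFin n) f

  ΣN : Fin n → (Fin n → ℤ) → ℤ
  ΣN u f = ΣV (λ v → if N u v then f v else 0ℤ)

  ΣI : ℕ → (ℕ → ℤ) → ℤ
  ΣI m f = ∑ (upTo m) (λ k → f (suc k))

  Constraint-a : (Y : Fin n → ℕ → ℤ) → Set
  Constraint-a Y = ΣV (λ v → Y v 1) ℤ.≤ 1ℤ

  Constraint-b : ℕ → (Y : Fin n → ℕ → ℤ) → Set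
  Constraint-b m Y = ∀ v → ΣI m (λ i → Y v i) ℤ.≤ 1ℤ

  Constraint-c : ℕ → (X : Fin n → ℕ → ℤ) → Set
  Constraint-c m X = ∀ u i → 2 ≤ i → i ≤ m → X u i ℤ.≤ X u (i ∸ 1)

  Constraint-d : ℕ → (X Y : Fin n → ℕ → ℤ) → Set
  Constraint-d m X Y = ∀ u i → 1 ≤ i → i ≤ m → ΣN u (λ v → Y v i) ℤ.≥ X u (i ∸ 1) - X u i

  Constraint-e : ℕ → (X Y : Fin n → ℕ → ℤ) → Set
  Constraint-e m X Y = ∀ u i → 1 ≤ i → i ≤ m → X u i + ΣN u (λ v → Y v i) ℤ.≤ 1ℤ

  Constraint-f : ℕ → (X Y : Fin n → ℕ → ℤ) → Set
  Constraint-f m X Y = ∀ v i → 2 ≤ i → i ≤ m → Y v i ℤ.≤ ΣN v (λ u → X u (i ∸ 1) - X u i)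

  Constraint-g : ℕ → (Y : Fin n → ℕ → ℤ) → Set
  Constraint-g m Y = ∀ i → 2 ≤ i → i ≤ m → ΣV (λ v → Y v i) ℤ.≤ ΣV (λ v → Y v (i ∸ 1))

  Constraint-h : ℕ → (Y : Fin n → ℕ → ℤ) → Set
  Constraint-h m Y = ∀ u → ΣI m (λ i → ΣN u (λ v → Y v i)) ℤ.≥ 1ℤ

  -- Definitionally the part of F8.Solution after the two binarity conditions.
  Constraints : ℕ → (X Y : Fin n → ℕ → ℤ) → Set
  Constraints m X Y = Constraint-a Y × Constraint-b m Y × Constraint-c m X × Constraint-d m X Y ×
                      Constraint-e m X Y × Constraint-f m X Y × Constraint-g m Y × Constraint-h m Y

  Constraints-cong : ∀ {m} → 1 ≤ m → ∀ {X Y X′ Y′} →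
    (∀ u i → i ≤ m → X u i ≡ X′ u i) → (∀ v i → i ≤ m → Y v i ≡ Y′ v i) →
    Constraints m X Y → Constraints m X′ Y′
  Constraints-cong {m} 1≤m {X} {Y} {X′} {Y′} X≗X′ Y≗Y′ (a , b , c , d , e , f , g , h) =
    subst (ℤ._≤ 1ℤ) (ΣV-cong (λ v → Y≗Y′ v 1 1≤m)) a ,
    (λ v → subst (ℤ._≤ 1ℤ) (ΣI-Y v) (b v)) ,
    (λ u i 2≤i i≤m → subst₂ ℤ._≤_ (X≗X′ u i i≤m) (X≗X′ u (i ∸ 1) (pred≤ i≤m)) (c u i 2≤i i≤m)) ,
    (λ u i 1≤i i≤m → subst₂ ℤ._≤_ (ΔX u i≤m) (ΣN-Y u i≤m) (d u i 1≤i i≤m)) ,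
    (λ u i 1≤i i≤m → subst (ℤ._≤ 1ℤ) (cong₂ _+_ (X≗X′ u i i≤m) (ΣN-Y u i≤m)) (e u i 1≤i i≤m)) ,
    (λ v i 2≤i i≤m → subst₂ ℤ._≤_ (Y≗Y′ v i i≤m) (ΣN-ΔX v i≤m) (f v i 2≤i i≤m)) ,
    (λ i 2≤i i≤m → subst₂ ℤ._≤_ (ΣV-cong (λ v → Y≗Y′ v i i≤m)) (ΣV-cong (λ v → Y≗Y′ v (i ∸ 1) (pred≤ i≤m)))
                                (g i 2≤i i≤m)) ,
    (λ u → subst (1ℤ ℤ.≤_) (∑-cong (upTo m) _ _ λ k k∈ → ΣN-Y u (∈-upTo⁻ k∈)) (h u))
    where
    pred≤ : ∀ {i} → i ≤ m → i ∸ 1 ≤ m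
    pred≤ {i} = ℕ.≤-trans (ℕ.m∸n≤m i 1)
    ΣV-cong : ∀ {f g : Fin n → ℤ} → (∀ v → f v ≡ g v) → ΣV f ≡ ΣV g
    ΣV-cong f≗g = ∑-cong (allFin n) _ _ (λ v _ → f≗g v)
    ΣN-cong : ∀ u {f g : Fin n → ℤ} → (∀ v → f v ≡ g v) → ΣN u f ≡ ΣN u g
    ΣN-cong u f≗g = ΣV-cong (λ v → cong (if N u v then_else 0ℤ) (f≗g v))
    ΣN-Y : ∀ u {i} → i ≤ m → ΣN u (λ v → Y v i) ≡ ΣN u (λ v → Y′ v i)
    ΣN-Y u i≤m = ΣN-cong u (λ v → Y≗Y′ v _ i≤m)
    ΣI-Y : ∀ v → ΣI m (Y v) ≡ ΣI m (Y′ v)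
    ΣI-Y v = ∑-cong (upTo m) _ _ (λ k k∈ → Y≗Y′ v (suc k) (∈-upTo⁻ k∈))
    ΔX : ∀ u {i} → i ≤ m → X u (i ∸ 1) - X u i ≡ X′ u (i ∸ 1) - X′ u i
    ΔX u {i} i≤m = cong₂ _-_ (X≗X′ u (i ∸ 1) (pred≤ i≤m)) (X≗X′ u i i≤m)
    ΣN-ΔX : ∀ v {i} → i ≤ m → ΣN v (λ u → X u (i ∸ 1) - X u i) ≡ ΣN v (λ u → X′ u (i ∸ 1) - X′ u i)
    ΣN-ΔX v i≤m = ΣN-cong v (λ u → ΔX u i≤m)

  xOf : List (Fin n) → Fin n → ℕ → ℤ
  xOf s u i = 𝟙 (not (covered s i u))

  yOf : List (Fin n) → Fin n → ℕ → ℤ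
  yOf s v zero    = 0ℤ
  yOf s v (suc k) = 𝟙 (occursAt s k v)

  xOf-zero : ∀ s u → xOf s u 0 ≡ 1ℤ
  xOf-zero s u = cong (𝟙 ∘ not) (covered-zero s u)

  yOf-isBit : ∀ s v i → IsBit (yOf s v i)
  yOf-isBit s v zero    = inj₁ refl
  yOf-isBit s v (suc k) = 𝟙-isBit (occursAt s k v)

  yOf≡1⇒occursAt : ∀ s v k → yOf s v (suc k) ≡ 1ℤ → occursAt s k v ≡ true
  yOf≡1⇒occursAt s v k = 𝟙-injective (occursAt s k v) true

  xOf-mono : ∀ s u k → xOf s u (suc k) ℤ.≤ xOf s u k
  xOf-mono s u k with covered s k u in cov
  ... | true rewrite covered-suc s k u cov = ℤ.≤-refl
  ... | false with covered s (suc k) u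
  ...   | true  = +≤+ z≤n
  ...   | false = ℤ.≤-refl

  ΣV-yOf≤1 : ∀ s k → ΣV (λ v → yOf s v (suc k)) ℤ.≤ 1ℤ
  ΣV-yOf≤1 s k = ∑-bits≤1 (allFin n) _ (allFin⁺ n) (λ v → yOf-isBit s v (suc k))
    (λ a b a-at-k b-at-k → occursAt-functional s k (yOf≡1⇒occursAt s a k a-at-k) (yOf≡1⇒occursAt s b k b-at-k))

  ΣN-yOf-nonneg : ∀ s u i → 0ℤ ℤ.≤ ΣN u (λ v → yOf s v i)
  ΣN-yOf-nonneg s u i = ∑-nonneg (allFin n) _ (λ v → IsBit⇒0≤ (if-isBit (N u v) (yOf-isBit s v i)))

  ΣN-yOf≤1 : ∀ s u k → ΣN u (λ v → yOf s v (suc k)) ℤ.≤ 1ℤ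
  ΣN-yOf≤1 s u k = ∑-bits≤1 (allFin n) _ (allFin⁺ n) (λ v → if-isBit (N u v) (yOf-isBit s v (suc k)))
    (λ a b a-at-k b-at-k → occursAt-functional s k (occurs a a-at-k) (occurs b b-at-k))
    where
    occurs : ∀ a → (if N u a then yOf s a (suc k) else 0ℤ) ≡ 1ℤ → occursAt s k a ≡ true
    occurs a a-at-k with N u a
    ... | true = yOf≡1⇒occursAt s a k a-at-k

  1≤ΣN-yOf : ∀ s u k {v} → occursAt s k v ≡ true → N u v ≡ true → 1ℤ ℤ.≤ ΣN u (λ v → yOf s v (suc k))
  1≤ΣN-yOf s u k {v} occ Nuv = ℤ.≤-trans 1≤term
    (term≤∑ (allFin n) _ (λ v → IsBit⇒0≤ (if-isBit (N u v) (yOf-isBit s v (suc k)))) (∈-allFin v))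
    where
    1≤term : 1ℤ ℤ.≤ (if N u v then yOf s v (suc k) else 0ℤ)
    1≤term rewrite Nuv | occ = ℤ.≤-refl

  1≤ΣN-yOf⇒∃ : ∀ s u k → 1ℤ ℤ.≤ ΣN u (λ v → yOf s v (suc k)) → ∃ λ v → occursAt s k v ≡ true × N u v ≡ true
  1≤ΣN-yOf⇒∃ s u k 1≤Σ =
    let v , _ , 1≤term = 1≤∑⇒∃ (allFin n) _ 1≤Σ
        Nuv , 1≤y = 1≤if⇒ (N u v) 1≤term
    in v , 1≤𝟙⇒true (occursAt s k v) 1≤y , Nuv

  ΣN-yOf≡0 : ∀ s u k → (∀ v → N u v ≡ true → occursAt s k v ≡ false) → ΣN u (λ v → yOf s v (suc k)) ≡ 0ℤ
  ΣN-yOf≡0 s u k none = ∑-zero (allFin n) _ term≡0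
    where
    term≡0 : ∀ v → (if N u v then yOf s v (suc k) else 0ℤ) ≡ 0ℤ
    term≡0 v with N u v in Nuv
    ... | false = refl
    ... | true rewrite none v Nuv = refl

  Footprinted : List (Fin n) → Set
  Footprinted s = ∀ k v → occursAt s (suc k) v ≡ true → ∃ λ w → N v w ≡ true × covered s (suc k) w ≡ false

  legal⇔unique×footprinted : ∀ s → Legal adj C s ⇔ (Unique s × Footprinted s)
  legal⇔unique×footprinted s = mk⇔ (λ legal → proj₁ legal , to legal) from
    where
    to : Legal adj C s → Footprinted s
    to (_ , legal) k v occ =
      let i , i≡1+k , sᵢ≡v = occursAt⇒lookup s (suc k) v occ
          w , Nsᵢw , earlier = legal i (subst (1 ≤_) (sym i≡1+k) (s≤s z≤n))
      in w , subst (λ a → N a w ≡ true) sᵢ≡v Nsᵢw ,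
         ¬N⇒uncovered s (suc k) w λ j v′ j<1+k occ′ →
           let j′ , j′≡j , sⱼ≡v′ = occursAt⇒lookup s j v′ occ′
           in subst (λ a → N a w ≡ false) sⱼ≡v′ (earlier j′ (subst₂ _<_ (sym j′≡j) (sym i≡1+k) j<1+k))
    from : Unique s × Footprinted s → Legal adj C s
    proj₁ (from (unique , _)) = unique
    proj₂ (from (_ , footprinted)) i 1≤i with toℕ i | occursAt-lookup s i
    ... | suc k | occ =
      let w , Nsᵢw , uncov = footprinted k (lookup s i) occ
      in w , Nsᵢw , λ j j<i → uncovered⇒¬N s uncov j<i (occursAt-lookup s j)

  dominating⇔ : ∀ s → Dominating adj C s ⇔ (∀ u → ∃ λ k → ∃ λ v → occursAt s k v ≡ true × N v u ≡ true)
  dominating⇔ s = mk⇔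
    (λ dom u → let v , v∈s , Nvu = find (dom u) ; k , occ = ∈⇒occursAt s v∈s in k , v , occ , Nvu)
    (λ dom u → let k , v , occ , Nvu = dom u in lose (occursAt⇒∈ s k occ) Nvu)

  module _ {m : ℕ} (s : List (Fin n)) where

    encoding-b : Unique s → Constraint-b m (yOf s)
    encoding-b unique v = ∑-bits≤1 (upTo m) _ (upTo⁺ m) (λ k → yOf-isBit s v (suc k))
      (λ j k j-occ k-occ → unique⇒occursOnce s unique j k v
                              (yOf≡1⇒occursAt s v j j-occ) (yOf≡1⇒occursAt s v k k-occ))

    encoding-c : ∀ u i → 2 ≤ i → xOf s u i ℤ.≤ xOf s u (i ∸ 1)
    encoding-c u (suc (suc k)) _        = xOf-mono s u (suc k)
    encoding-c u (suc zero)    (s≤s ())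

    encoding-d : ∀ u i → 1 ≤ i → xOf s u (i ∸ 1) - xOf s u i ℤ.≤ ΣN u (λ v → yOf s v i)
    encoding-d u (suc k) _ with covered s k u in cov
    ... | true rewrite covered-suc s k u cov = ΣN-yOf-nonneg s u (suc k)
    ... | false with covered s (suc k) u in cov′
    ...   | true  = let v , occ , Nvu = newly-covered s k u cov cov′
                    in 1≤ΣN-yOf s u k occ (trans (N-sym u v) Nvu)
    ...   | false = ΣN-yOf-nonneg s u (suc k)

    uncovered⇒¬occursAt : ∀ u k v → covered s (suc k) u ≡ false → N u v ≡ true → occursAt s k v ≡ false
    uncovered⇒¬occursAt u k v uncov Nuv with occursAt s k v in occ
    ... | false = refl
    ... | true with trans (sym (uncovered⇒¬N s uncov (ℕ.n<1+n k) occ)) (trans (N-sym v u) Nuv)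
    ...   | ()

    encoding-e : ∀ u i → 1 ≤ i → xOf s u i + ΣN u (λ v → yOf s v i) ℤ.≤ 1ℤ
    encoding-e u (suc k) _ with covered s (suc k) u in cov
    ... | true  = subst (ℤ._≤ 1ℤ) (sym (ℤ.+-identityˡ _)) (ΣN-yOf≤1 s u k)
    ... | false rewrite ΣN-yOf≡0 s u k (λ v → uncovered⇒¬occursAt u k v cov) = ℤ.≤-refl

    ΔxOf-masked-nonneg : ∀ v k u → 0ℤ ℤ.≤ (if N v u then xOf s u k - xOf s u (suc k) else 0ℤ)
    ΔxOf-masked-nonneg v k u with N v u
    ... | true  = ℤ.i≤j⇒0≤j-i (xOf-mono s u k)
    ... | false = ℤ.≤-refl

    1≤ΔxOf-at-footprint : ∀ {k v w} → occursAt s (suc k) v ≡ true → N v w ≡ true → covered s (suc k) w ≡ false →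
                          1ℤ ℤ.≤ (if N v w then xOf s w (suc k) - xOf s w (suc (suc k)) else 0ℤ)
    1≤ΔxOf-at-footprint {k} occ Nvw uncov rewrite Nvw | uncov | ∃⇒covered s (ℕ.n<1+n (suc k)) occ Nvw = ℤ.≤-refl

    encoding-f : Footprinted s → ∀ v i → 2 ≤ i → yOf s v i ℤ.≤ ΣN v (λ u → xOf s u (i ∸ 1) - xOf s u i)
    encoding-f footprinted v (suc zero)    (s≤s ())
    encoding-f footprinted v (suc (suc k)) _ with occursAt s (suc k) v in occ
    ... | false = ∑-nonneg (allFin n) _ (ΔxOf-masked-nonneg v (suc k))
    ... | true  = let w , Nvw , uncov = footprinted k v occ
                  in ℤ.≤-trans (1≤ΔxOf-at-footprint occ Nvw uncov)
                       (term≤∑ (allFin n) _ (ΔxOf-masked-nonneg v (suc k)) (∈-allFin w))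

    encoding-g : ∀ i → 2 ≤ i → ΣV (λ v → yOf s v i) ℤ.≤ ΣV (λ v → yOf s v (i ∸ 1))
    encoding-g (suc zero)    (s≤s ())
    encoding-g (suc (suc k)) _ with suc k ℕ.<? length s
    ... | yes 1+k<len =
      let v , occ = <⇒occursAt s k (ℕ.<-trans (ℕ.n<1+n k) 1+k<len)
      in ℤ.≤-trans (ΣV-yOf≤1 s (suc k))
           (subst (λ b → 𝟙 b ℤ.≤ ΣV (λ v → yOf s v (suc k))) occ
             (term≤∑ (allFin n) _ (λ v → IsBit⇒0≤ (yOf-isBit s v (suc k))) (∈-allFin v)))
    ... | no 1+k≮len rewrite ∑-zero (allFin n) (λ v → yOf s v (suc (suc k)))
                               (λ v → cong 𝟙 (occursAt-beyond s (suc k) v (ℕ.≮⇒≥ 1+k≮len)))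
                       = ∑-nonneg (allFin n) _ (λ v → IsBit⇒0≤ (yOf-isBit s v (suc k)))

    encoding-h : length s ≤ m → Dominating adj C s → Constraint-h m (yOf s)
    encoding-h len≤m dominating u =
      let k , v , occ , Nvu = Equivalence.to (dominating⇔ s) dominating u
      in ℤ.≤-trans (1≤ΣN-yOf s u k occ (trans (N-sym u v) Nvu))
           (term≤∑ (upTo m) (λ k → ΣN u (λ v → yOf s v (suc k))) (λ k → ΣN-yOf-nonneg s u (suc k))
             (∈-upTo⁺ (ℕ.<-≤-trans (occursAt⇒< s k occ) len≤m)))

    encoding-satisfies : LegalDominating adj C s → length s ≤ m → Constraints m (xOf s) (yOf s)
    encoding-satisfies (legal , dominating) len≤m =
      let unique , footprinted = Equivalence.to (legal⇔unique×footprinted s) legal in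
      ΣV-yOf≤1 s 0 ,
      encoding-b unique ,
      (λ u i 2≤i _ → encoding-c u i 2≤i) ,
      (λ u i 1≤i _ → encoding-d u i 1≤i) ,
      (λ u i 1≤i _ → encoding-e u i 1≤i) ,
      (λ v i 2≤i _ → encoding-f footprinted v i 2≤i) ,
      (λ i 2≤i _ → encoding-g i 2≤i) ,
      encoding-h len≤m dominating

    occursAt⇒<m : length s ≤ m → ∀ {k v} → occursAt s k v ≡ true → k < m
    occursAt⇒<m len≤m {k} occ = ℕ.<-≤-trans (occursAt⇒< s k occ) len≤m

    1≤ΔxOf⇒uncovered : ∀ u k → 1ℤ ℤ.≤ xOf s u k - xOf s u (suc k) → covered s k u ≡ false
    1≤ΔxOf⇒uncovered u k 1≤Δ with covered s k u | covered s (suc k) u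
    ... | false | _     = refl
    ... | true  | true  with 1≤Δ
    ...   | +≤+ ()
    1≤ΔxOf⇒uncovered u k () | true | false

    occursOnce-of-b : length s ≤ m → Constraint-b m (yOf s) → OccursOnce s
    occursOnce-of-b len≤m b j k v occ₁ occ₂ =
      ∑≤1⇒one-is-unique (upTo m) (λ k → yOf s v (suc k)) (λ k → IsBit⇒0≤ (yOf-isBit s v (suc k))) (b v)
        (∈-upTo⁺ (occursAt⇒<m len≤m occ₁)) (∈-upTo⁺ (occursAt⇒<m len≤m occ₂)) (cong 𝟙 occ₁) (cong 𝟙 occ₂)

    footprinted-of-f : length s ≤ m → Constraint-f m (xOf s) (yOf s) → Footprinted s
    footprinted-of-f len≤m f k v occ =
      let 1≤y = subst (λ b → 1ℤ ℤ.≤ 𝟙 b) (sym occ) ℤ.≤-refl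
          w , _ , 1≤term = 1≤∑⇒∃ (allFin n) _
                             (ℤ.≤-trans 1≤y (f v (suc (suc k)) (s≤s (s≤s z≤n)) (occursAt⇒<m len≤m occ)))
          Nvw , 1≤Δ = 1≤if⇒ (N v w) 1≤term
      in w , Nvw , 1≤ΔxOf⇒uncovered w (suc k) 1≤Δ

    dominating-of-h : Constraint-h m (yOf s) → Dominating adj C s
    dominating-of-h h = Equivalence.from (dominating⇔ s) λ u →
      let k , _ , 1≤Σ = 1≤∑⇒∃ (upTo m) _ (h u)
          v , occ , Nuv = 1≤ΣN-yOf⇒∃ s u k 1≤Σ
      in k , v , occ , trans (N-sym v u) Nuv

    legalDominating-of-constraints : length s ≤ m → Constraints m (xOf s) (yOf s) → LegalDominating adj C s
    legalDominating-of-constraints len≤m (_ , b , _ , _ , _ , f , _ , h) =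
      Equivalence.from (legal⇔unique×footprinted s)
        (occursOnce⇒unique s (occursOnce-of-b len≤m b) , footprinted-of-f len≤m f) ,
      dominating-of-h h

  record IsSequenceMatrix (r : ℕ) (Z : ℕ → Fin n → ℤ) : Set where
    field
      isBit      : ∀ k v → IsBit (Z k v)
      one-unique : ∀ k {v w} → Z k v ≡ 1ℤ → Z k w ≡ 1ℤ → v ≡ w
      zero-stays : ∀ k → (∀ v → Z k v ≡ 0ℤ) → ∀ v → Z (suc k) v ≡ 0ℤ
      zero-from  : ∀ k v → r ≤ k → Z k v ≡ 0ℤ

    zero-column⇒zero : (∀ v → Z 0 v ≡ 0ℤ) → ∀ k v → Z k v ≡ 0ℤ
    zero-column⇒zero Z₀≡0 zero    = Z₀≡0
    zero-column⇒zero Z₀≡0 (suc k) = zero-stays k (zero-column⇒zero Z₀≡0 k)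

  IsSequenceMatrix-shift : ∀ {r Z} → IsSequenceMatrix (suc r) Z → IsSequenceMatrix r (Z ∘ suc)
  IsSequenceMatrix-shift M = record
    { isBit      = isBit ∘ suc
    ; one-unique = one-unique ∘ suc
    ; zero-stays = zero-stays ∘ suc
    ; zero-from  = λ k v r≤k → zero-from (suc k) v (s≤s r≤k)
    }
    where open IsSequenceMatrix M

  decode : ℕ → (ℕ → Fin n → ℤ) → List (Fin n)
  decode zero    Z = []
  decode (suc r) Z with any? (λ v → Z 0 v ℤ.≟ 1ℤ)
  ... | yes (v , _) = v ∷ decode r (Z ∘ suc)
  ... | no  _       = []

  decode-length : ∀ r Z → length (decode r Z) ≤ r
  decode-length zero    Z = z≤n
  decode-length (suc r) Z with any? (λ v → Z 0 v ℤ.≟ 1ℤ)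
  ... | yes _ = s≤s (decode-length r (Z ∘ suc))
  ... | no  _ = z≤n

  decode-correct : ∀ r Z → IsSequenceMatrix r Z → ∀ k v → Z k v ≡ 𝟙 (occursAt (decode r Z) k v)
  decode-correct zero Z M k v = IsSequenceMatrix.zero-from M k v z≤n
  decode-correct (suc r) Z M with any? (λ v → Z 0 v ℤ.≟ 1ℤ)
  ... | yes (a , Z₀a≡1) = correct
    where
    open IsSequenceMatrix M
    correct : ∀ k v → Z k v ≡ 𝟙 (occursAt (a ∷ decode r (Z ∘ suc)) k v)
    correct (suc k) v = decode-correct r (Z ∘ suc) (IsSequenceMatrix-shift M) k v
    correct zero    v with a ≟ v | isBit 0 v
    ... | yes refl | _            = Z₀a≡1
    ... | no  _    | inj₁ Z₀v≡0   = Z₀v≡0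
    ... | no  a≢v  | inj₂ Z₀v≡1   = ⊥-elim (a≢v (one-unique 0 Z₀a≡1 Z₀v≡1))
  ... | no ∄one = λ k v → IsSequenceMatrix.zero-column⇒zero M Z₀≡0 k v
    where
    Z₀≡0 : ∀ v → Z 0 v ≡ 0ℤ
    Z₀≡0 v with IsSequenceMatrix.isBit M 0 v
    ... | inj₁ Z₀v≡0 = Z₀v≡0
    ... | inj₂ Z₀v≡1 = ⊥-elim (∄one (v , Z₀v≡1))

  -- F8.nth does not use the parameters of F8; they are abstracted only to be able to name it.
  module _ {m : ℕ} (x y : Vec (Vec ℤ m) n) where
    open F8 adj C m x y using (nth)

    nth-isBit : ∀ {m′} (a : Vec ℤ m′) → (∀ i → IsBit (Vec.lookup a i)) → ∀ k → IsBit (nth (Vec.toList a) k)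
    nth-isBit []      _    k       = inj₁ refl
    nth-isBit (c ∷ a) bits zero    = bits Fin.zero
    nth-isBit (c ∷ a) bits (suc k) = nth-isBit a (bits ∘ Fin.suc) k

    nth-beyond : ∀ {m′} (a : Vec ℤ m′) k → m′ ≤ k → nth (Vec.toList a) k ≡ 0ℤ
    nth-beyond []      k       _           = refl
    nth-beyond (c ∷ a) (suc k) (s≤s m′≤k) = nth-beyond a k m′≤k

    nth-tabulate : ∀ m′ (h : ℕ → ℤ) k → k < m′ → nth (Vec.toList (Vec.tabulate {n = m′} (h ∘ toℕ))) k ≡ h k
    nth-tabulate (suc m′) h zero    _         = refl
    nth-tabulate (suc m′) h (suc k) (s≤s k<m′) = nth-tabulate m′ (h ∘ suc) k k<m′

    nth-ext : ∀ {m′} (a b : Vec ℤ m′) → (∀ k → k < m′ → nth (Vec.toList a) k ≡ nth (Vec.toList b) k) → a ≡ b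
    nth-ext []      []      _    = refl
    nth-ext (c ∷ a) (d ∷ b) a≗b = cong₂ _∷_ (a≗b 0 (s≤s z≤n)) (nth-ext a b (λ k k<m′ → a≗b (suc k) (s≤s k<m′)))

    tabulate-nth : ∀ {m′ n′} (h : Fin n′ → ℕ → ℤ) (a : Vec (Vec ℤ m′) n′) →
                   (∀ u k → k < m′ → h u k ≡ nth (Vec.toList (Vec.lookup a u)) k) →
                   Vec.tabulate (λ u → Vec.tabulate (λ k → h u (toℕ k))) ≡ a
    tabulate-nth {m′} h a h≗a = trans
      (Vec.tabulate-cong λ u → nth-ext _ _ λ k k<m′ → trans (nth-tabulate m′ (h u) k k<m′) (h≗a u k k<m′))
      (Vec.tabulate∘lookup a)

  encode : ∀ m → List (Fin n) → Vec (Vec ℤ m) n × Vec (Vec ℤ m) n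
  encode m s = Vec.tabulate (λ u → Vec.tabulate (λ k → xOf s u (suc (toℕ k)))) ,
               Vec.tabulate (λ v → Vec.tabulate (λ k → yOf s v (suc (toℕ k))))

  module Decoding {m : ℕ} (x y : Vec (Vec ℤ m) n) where
    open F8 adj C m x y using (X; Y)

    column : ℕ → Fin n → ℤ
    column k v = Y v (suc k)

    decoded : List (Fin n)
    decoded = decode m column

    column-beyond : ∀ k v → m ≤ k → column k v ≡ 0ℤ
    column-beyond k v = nth-beyond x y (Vec.lookup y v) k

    column-sum≤1 : Constraint-a Y → Constraint-g m Y → ∀ k → ΣV (column k) ℤ.≤ 1ℤ
    column-sum≤1 a g zero    = a
    column-sum≤1 a g (suc k) with suc (suc k) ℕ.≤? m
    ... | yes 2+k≤m = ℤ.≤-trans (g (suc (suc k)) (s≤s (s≤s z≤n)) 2+k≤m) (column-sum≤1 a g k)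
    ... | no  2+k≰m rewrite ∑-zero (allFin n) (column (suc k))
                              (λ v → column-beyond (suc k) v (ℕ.≤-pred (ℕ.≰⇒> 2+k≰m)))
                      = +≤+ z≤n

    columns-isSequenceMatrix : (∀ v i → IsBit (Vec.lookup (Vec.lookup y v) i)) →
                               Constraint-a Y → Constraint-g m Y → IsSequenceMatrix m column
    columns-isSequenceMatrix y-bits a g = record
      { isBit      = isBit
      ; one-unique = λ k → ∑≤1⇒one-is-unique (allFin n) (column k) (λ v → IsBit⇒0≤ (isBit k v))
                             (column-sum≤1 a g k) (∈-allFin _) (∈-allFin _)
      ; zero-stays = zero-stays
      ; zero-from  = column-beyond
      }
      where
      isBit : ∀ k v → IsBit (column k v)
      isBit k v = nth-isBit x y (Vec.lookup y v) (y-bits v) k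
      zero-stays : ∀ k → (∀ v → column k v ≡ 0ℤ) → ∀ v → column (suc k) v ≡ 0ℤ
      zero-stays k column≡0 v with suc (suc k) ℕ.≤? m | isBit (suc k) v
      ... | no  2+k≰m | _   = column-beyond (suc k) v (ℕ.≤-pred (ℕ.≰⇒> 2+k≰m))
      ... | yes _     | inj₁ column≡0′ = column≡0′
      ... | yes 2+k≤m | inj₂ column≡1
        with ℤ.≤-trans (term≤∑ (allFin n) (column (suc k)) (λ v → IsBit⇒0≤ (isBit (suc k) v)) (∈-allFin v))
                       (g (suc (suc k)) (s≤s (s≤s z≤n)) 2+k≤m)
      ... | 1≤0 rewrite column≡1 | ∑-zero (allFin n) (column k) column≡0 with 1≤0
      ...   | +≤+ ()

    module _ (M : IsSequenceMatrix m column) where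

      Y≡yOf : ∀ v i → Y v i ≡ yOf decoded v i
      Y≡yOf v zero    = refl
      Y≡yOf v (suc k) = decode-correct m column M k v

      ΣN-Y≡ΣN-yOf : ∀ u i → ΣN u (λ v → Y v i) ≡ ΣN u (λ v → yOf decoded v i)
      ΣN-Y≡ΣN-yOf u i = ∑-cong (allFin n) _ _ (λ v _ → cong (if N u v then_else 0ℤ) (Y≡yOf v i))

      module _ (c : Constraint-c m X) (d : Constraint-d m X Y) (e : Constraint-e m X Y) where

        X≡1⇒uncovered : ∀ u k → suc k ≤ m → X u k ≡ xOf decoded u k → X u (suc k) ≡ 1ℤ →
                        covered decoded (suc k) u ≡ false
        X≡1⇒uncovered u k 1+k≤m IH X≡1 with covered decoded k u in cov
        X≡1⇒uncovered u zero 1+k≤m IH X≡1 | true with trans (sym (covered-zero decoded u)) cov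
        ... | ()
        X≡1⇒uncovered u (suc k) 2+k≤m IH X≡1 | true
          with subst₂ ℤ._≤_ X≡1 IH (c u (suc (suc k)) (s≤s (s≤s z≤n)) 2+k≤m)
        ... | +≤+ ()
        X≡1⇒uncovered u k 1+k≤m IH X≡1 | false with covered decoded (suc k) u in cov′
        ... | false = refl
        ... | true
          with newly-covered decoded k u cov cov′
        ... | v , occ , Nvu
          with ℤ.≤-trans (ℤ.+-monoʳ-≤ 1ℤ (subst (1ℤ ℤ.≤_) (sym (ΣN-Y≡ΣN-yOf u (suc k)))
                                             (1≤ΣN-yOf decoded u k occ (trans (N-sym u v) Nvu))))
                         (subst (λ z → z + ΣN u (λ v → Y v (suc k)) ℤ.≤ 1ℤ) X≡1 (e u (suc k) (s≤s z≤n) 1+k≤m))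
        ... | +≤+ (s≤s ())

        X≡0⇒covered : ∀ u k → suc k ≤ m → X u k ≡ xOf decoded u k → X u (suc k) ≡ 0ℤ →
                      covered decoded (suc k) u ≡ true
        X≡0⇒covered u k 1+k≤m IH X≡0 with covered decoded k u in cov
        ... | true  = covered-suc decoded k u cov
        ... | false =
          let 1≤ΣN = subst₂ ℤ._≤_ (cong₂ _-_ IH X≡0) (ΣN-Y≡ΣN-yOf u (suc k)) (d u (suc k) (s≤s z≤n) 1+k≤m)
              v , occ , Nuv = 1≤ΣN-yOf⇒∃ decoded u k 1≤ΣN
          in ∃⇒covered decoded (ℕ.n<1+n k) occ (trans (N-sym v u) Nuv)

        X≡xOf : (∀ u i → IsBit (Vec.lookup (Vec.lookup x u) i)) → ∀ u i → i ≤ m → X u i ≡ xOf decoded u i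
        X≡xOf x-bits u zero    _     = sym (xOf-zero decoded u)
        X≡xOf x-bits u (suc k) 1+k≤m = by-bit (nth-isBit x y (Vec.lookup x u) (x-bits u) k)
          where
          IH : X u k ≡ xOf decoded u k
          IH = X≡xOf x-bits u k (ℕ.≤-trans (ℕ.n≤1+n k) 1+k≤m)
          by-bit : IsBit (X u (suc k)) → X u (suc k) ≡ xOf decoded u (suc k)
          by-bit (inj₁ X≡0) = trans X≡0 (sym (cong (𝟙 ∘ not) (X≡0⇒covered u k 1+k≤m IH X≡0)))
          by-bit (inj₂ X≡1) = trans X≡1 (sym (cong (𝟙 ∘ not) (X≡1⇒uncovered u k 1+k≤m IH X≡1)))

    decoded-isSequenceMatrix : F8.Solution adj C m x y → IsSequenceMatrix m column
    decoded-isSequenceMatrix (_ , y-bits , a , _ , _ , _ , _ , _ , g , _) = columns-isSequenceMatrix y-bits a g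

    decoded-Y≡yOf : F8.Solution adj C m x y → ∀ v i → Y v i ≡ yOf decoded v i
    decoded-Y≡yOf sol = Y≡yOf (decoded-isSequenceMatrix sol)

    decoded-X≡xOf : F8.Solution adj C m x y → ∀ u i → i ≤ m → X u i ≡ xOf decoded u i
    decoded-X≡xOf sol@(x-bits , _ , _ , _ , c , d , e , _) =
      X≡xOf (decoded-isSequenceMatrix sol) c d e x-bits

    decoded-legalDominating : 1 ≤ m → F8.Solution adj C m x y → LegalDominating adj C decoded
    decoded-legalDominating 1≤m sol@(_ , _ , constraints) =
      legalDominating-of-constraints decoded (decode-length m column)
        (Constraints-cong 1≤m (decoded-X≡xOf sol) (λ v i _ → decoded-Y≡yOf sol v i) constraints)

    encode-decoded : F8.Solution adj C m x y → encode m decoded ≡ (x , y)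
    encode-decoded sol = cong₂ _,_
      (tabulate-nth x y (λ u k → xOf decoded u (suc k)) x (λ u k k<m → sym (decoded-X≡xOf sol u (suc k) k<m)))
      (tabulate-nth x y (λ v k → yOf decoded v (suc k)) y (λ v k _ → sym (decoded-Y≡yOf sol v (suc k))))

  module _ {m : ℕ} (s : List (Fin n)) where
    private
      x y : Vec (Vec ℤ m) n
      x = proj₁ (encode m s)
      y = proj₂ (encode m s)
    open F8 adj C m x y using (X; Y)

    encode-X : ∀ u i → i ≤ m → X u i ≡ xOf s u i
    encode-X u zero    _     = sym (xOf-zero s u)
    encode-X u (suc k) 1+k≤m = trans (cong (λ a → F8.nth adj C m x y (Vec.toList a) k) (Vec.lookup∘tabulate _ u))
                                     (nth-tabulate x y m (λ k → xOf s u (suc k)) k 1+k≤m)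

    encode-Y : ∀ v i → i ≤ m → Y v i ≡ yOf s v i
    encode-Y v zero    _     = refl
    encode-Y v (suc k) 1+k≤m = trans (cong (λ a → F8.nth adj C m x y (Vec.toList a) k) (Vec.lookup∘tabulate _ v))
                                     (nth-tabulate x y m (λ k → yOf s v (suc k)) k 1+k≤m)

    encode-solution : 1 ≤ m → LegalDominating adj C s → length s ≤ m →
                      F8Solution adj C m (encode m s)
    encode-solution 1≤m ld len≤m =
      (λ u i → subst IsBit (sym (lookup-tabulate² (xOf s) u i)) (𝟙-isBit _)) ,
      (λ v i → subst IsBit (sym (lookup-tabulate² (yOf s) v i)) (𝟙-isBit _)) ,
      Constraints-cong 1≤m (λ u i i≤m → sym (encode-X u i i≤m)) (λ v i i≤m → sym (encode-Y v i i≤m))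
        (encoding-satisfies s ld len≤m)
      where
      lookup-tabulate² : ∀ (h : Fin n → ℕ → ℤ) u (i : Fin m) →
        Vec.lookup (Vec.lookup (Vec.tabulate (λ u → Vec.tabulate (λ k → h u (suc (toℕ k))))) u) i
          ≡ h u (suc (toℕ i))
      lookup-tabulate² h u i =
        trans (cong (λ a → Vec.lookup a i) (Vec.lookup∘tabulate _ u)) (Vec.lookup∘tabulate _ i)

    decode-encode : 1 ≤ m → LegalDominating adj C s → length s ≤ m →
                    Decoding.decoded x y ≡ s
    decode-encode 1≤m ld len≤m = occursAt-ext decoded s same-positions
      where
      open Decoding x y using (decoded; column; decoded-Y≡yOf)
      same-positions : ∀ k v → occursAt decoded k v ≡ occursAt s k v
      same-positions k v with k ℕ.<? m
      ... | yes k<m = 𝟙-injective _ _ (trans (sym (decoded-Y≡yOf (encode-solution 1≤m ld len≤m) v (suc k)))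
                                             (encode-Y v (suc k) k<m))
      ... | no  k≮m = trans (occursAt-beyond decoded k v (ℕ.≤-trans (decode-length m column) (ℕ.≮⇒≥ k≮m)))
                            (sym (occursAt-beyond s k v (ℕ.≤-trans len≤m (ℕ.≮⇒≥ k≮m))))

  correspondence : ∀ m → 1 ≤ m → (∀ s → LegalDominating adj C s → length s ≤ m) → OneToOne adj C m
  correspondence m 1≤m fits =
    encode m ,
    (λ (x , y) → Decoding.decoded x y) ,
    (λ s ld → encode-solution s 1≤m ld (fits s ld)) ,
    (λ (x , y) → Decoding.decoded-legalDominating x y 1≤m) ,
    (λ s ld → decode-encode s 1≤m ld (fits s ld)) ,
    (λ (x , y) → Decoding.encode-decoded x y)

-- The hypothesis that no vertex outside C is isolated only guarantees that legal dominating
-- sequences exist; the correspondence itself does not need it.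
mainTheorem8 : (n : ℕ) (adj : Fin n → Fin n → Bool) (C : Fin n → Bool) →
    SimpleGraph n adj → NoIsolatedOutsideC n adj C →
    (m : ℕ) → 1 ≤ m → (γ : ℕ) → IsGrundyDominationNumber adj C γ → γ ≤ m →
    OneToOne adj C m
mainTheorem8 n adj C simple _ m 1≤m γ (_ , γ-maximal) γ≤m =
  correspondence m 1≤m (λ s ld → ℕ.≤-trans (γ-maximal s ld) γ≤m)
  where open Formulation C simple
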